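{- Let $n\ge 3$ and $S_f=\{f,rf\}\subseteq D_n$. Then (a) $\lambda_1(D_n,S_f)\le n$, and (b) $\lambda_2(D_n,S_f)=2$.
   Context: The dihedral group $D_n$ is the group of order $2n$ with presentation $\langle r,f\mid r^n=f^2=1,\ rf=fr^{ -1}\rangle$; its elements are $1,r,\dots,r^{n-1},f,\dots,r^{n-1}f$. For a generating set $S$ of a finite group $G$ and $g\in G$, $l_S(g)$ is the minimal number of factors in an expression of $g$ as a product of elements of $S$ ($l_S(1)=0$). Define $\lambda_1(G,S)=\max_{g\in G,\,s\in S} l_S(gsg^{ -1})$ and $\lambda_2(G,S)=\max_{g\in G,\,s,s'\in S} l_S(gss'g^{ -1})$. -}

module Defs where

open import Data.Nat using (ℕ; _+_; _∸_; _≤_; NonZero)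
open import Data.Nat.DivMod using (_%_; m%n<n)
open import Data.Fin using (Fin; toℕ; fromℕ<)
open import Data.Bool using (Bool; true; false; if_then_else_; _xor_)
open import Data.Product using (Σ; _×_; _,_)
open import Data.List using (List; []; _∷_; foldr; length)
open import Data.List.Relation.Unary.All using (All)
open import Data.List.Membership.Propositional using (_∈_)
open import Relation.Binary.PropositionalEquality using (_≡_)

-- The pair (k , b) represents the element r^k f^b  (b = true means f^1).
-- Multiplication follows from r^n = f^2 = 1 and f r = r^{-1} f:
--   (r^a f^x)(r^b f^y) = r^(a + (-1)^x b) f^(x xor y).

module _ (n : ℕ) .{{_ : NonZero n}} where

  Dih : Set
  Dih = Fin n × Bool

  fin : ℕ → Fin n
  fin k = fromℕ< (m%n<n k n)

  _·_ : Dih → Dih → Dih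
  (a , x) · (b , y) = fin (toℕ a + (if x then n ∸ toℕ b else toℕ b)) , (x xor y)

  one : Dih
  one = fin 0 , false

  inv : Dih → Dih
  inv (a , false) = fin (n ∸ toℕ a) , false
  inv (a , true)  = a , true

  rot : Dih
  rot = fin 1 , false

  flp : Dih
  flp = fin 0 , true

  S-f : List Dih
  S-f = flp ∷ (rot · flp) ∷ []

  prod : List Dih → Dih
  prod = foldr _·_ one

  IsWord : List Dih → List Dih → Dih → Set
  IsWord S w g = All (_∈ S) w × prod w ≡ g

  IsWordLength : List Dih → Dih → ℕ → Set
  IsWordLength S g k =
    (Σ (List Dih) λ w → IsWord S w g × length w ≡ k) ×
    (∀ w → IsWord S w g → k ≤ length w)

  Lambda1≤ : List Dih → ℕ → Set
  Lambda1≤ S m = ∀ g s → s ∈ S →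
    Σ ℕ λ k → IsWordLength S ((g · s) · inv g) k × k ≤ m

  Lambda2≡ : List Dih → ℕ → Set
  Lambda2≡ S m =
    (∀ g s s' → s ∈ S → s' ∈ S →
       Σ ℕ λ k → IsWordLength S (((g · s) · s') · inv g) k × k ≤ m) ×
    (Σ Dih λ g → Σ Dih λ s → Σ Dih λ s' → s ∈ S × s' ∈ S ×
       IsWordLength S (((g · s) · s') · inv g) m)

-- Write elements of D_n as r^k f^b.  The proof rests on two facts about
-- conjugation: a conjugate of a reflection is again a reflection, and a
-- conjugate of a product s t of two reflections is either s t (conjugating by
-- a rotation) or t s (conjugating by a reflection).
--
-- (a) Every reflection r^k f is an alternating word (rf · f)^j rf = r^(j+1) f
--     or (f · rf)^m f = r^(-m) f of odd length at most n, since every residue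
--     k is j + 1 or -m with 2j + 1 ≤ n, resp. 2m + 1 ≤ n.
-- (b) Hence g s s' g⁻¹ is always s s' or s' s, a word of length 2, and
--     r = 1 · rf · f · 1⁻¹ needs two letters, being neither 1 nor a reflection.
module Submission where

open import Level using (0ℓ)
open import Function using (_∘_)
open import Data.Empty using (⊥-elim)
open import Data.Bool using (true; false; not)
open import Data.Bool.Properties as Bool using ()
open import Data.Nat using (ℕ; zero; suc; _+_; _*_; _∸_; _≤_; _<_; z≤n; s≤s; NonZero; >-nonZero⁻¹; _≤?_)
open import Data.Nat.Properties
open import Data.Nat.DivMod using (_%_; m%n<n; %-distribˡ-+; %-distribˡ-*; m%n%n≡m%n; n%n≡0; m<n⇒m%n≡m)
open import Data.Fin using (toℕ)
open import Data.Fin.Properties as Fin using (toℕ-fromℕ<; toℕ-injective; toℕ<n)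
open import Data.Product using (Σ; _×_; _,_; proj₁; proj₂)
open import Data.Product.Properties using (≡-dec)
open import Data.Sum using (_⊎_; inj₁; inj₂)
open import Data.List using (List; []; _∷_; length; cartesianProductWith)
open import Data.List.Relation.Unary.All using (All; []; _∷_)
open import Data.List.Relation.Unary.Any using (Any; here; there; any?)
open import Data.List.Membership.Propositional using (_∈_; find; lose)
open import Data.List.Membership.Propositional.Properties
  using (∈-cartesianProductWith⁺; ∈-cartesianProductWith⁻)
open import Algebra.Properties.CommutativeSemigroup +-commutativeSemigroup
  using (xy∙z≈xz∙y; xy∙z≈y∙zx)
open import Relation.Nullary using (Dec; yes; no)
open import Relation.Unary using (Pred; Decidable)
open import Relation.Binary.Bundles using (Setoid)
import Relation.Binary.Construct.On as On
open import Relation.Binary.PropositionalEquality as ≡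
  using (_≡_; _≢_; refl; sym; trans; cong; cong₂; subst)

open import Defs

least : ∀ {p} {P : Pred ℕ p} → Decidable P → ∀ d → P d →
        Σ ℕ λ k → P k × (∀ j → P j → k ≤ j)
least P? d Pd with P? 0
... | yes P0 = 0 , P0 , λ _ _ → z≤n
least P? zero    P0 | no ¬P0 = ⊥-elim (¬P0 P0)
least {P = P} P? (suc d) Pd | no ¬P0 with least (P? ∘ suc) d Pd
... | k , Pk , min = suc k , Pk , minimal
  where
  minimal : ∀ j → P j → suc k ≤ j
  minimal zero    P0 = ⊥-elim (¬P0 P0)
  minimal (suc j) Pj = s≤s (min j Pj)

-- Over a finite alphabet S, the words of each fixed length
-- can be listed, so "some S-word of length j satisfies Q" is decidable for
-- decidable Q; the least number principle then yields a shortest such word.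
module ShortestWord {A : Set} (S : List A) {q} {Q : Pred (List A) q} (Q? : Decidable Q) where

  Admissible : List A → Set q
  Admissible w = All (_∈ S) w × Q w

  words : ℕ → List (List A)
  words zero    = [] ∷ []
  words (suc j) = cartesianProductWith _∷_ S (words j)

  words-sound : ∀ j {w} → w ∈ words j → All (_∈ S) w × length w ≡ j
  words-sound zero    (here refl) = [] , refl
  words-sound (suc j) w∈ with ∈-cartesianProductWith⁻ _∷_ S (words j) w∈
  ... | s , w , s∈S , w∈ , refl with words-sound j w∈
  ...   | all , len = s∈S ∷ all , cong suc len

  words-complete : ∀ {w} → All (_∈ S) w → w ∈ words (length w)
  words-complete []           = here refl
  words-complete (s∈S ∷ all) = ∈-cartesianProductWith⁺ _∷_ s∈S (words-complete all)

  HasLength : Pred ℕ q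
  HasLength j = Any Q (words j)

  hasLength? : Decidable HasLength
  hasLength? j = any? Q? (words j)

  shortest : ∀ {w} → Admissible w →
             Σ ℕ λ k → (Σ (List A) λ v → Admissible v × length v ≡ k) ×
                       (∀ v → Admissible v → k ≤ length v)
  shortest {w} (all , Qw) with least hasLength? (length w) (lose (words-complete all) Qw)
  ... | k , hasK , min with find hasK
  ...   | v , v∈ , Qv with words-sound k v∈
  ...     | allv , len = k , (v , (allv , Qv) , len) , minimal
    where
    minimal : ∀ u → Admissible u → k ≤ length u
    minimal u (allu , Qu) = min (length u) (lose (words-complete allu) Qu)

module Modular (n : ℕ) .{{_ : NonZero n}} where

  infix 4 _≡ₘ_
  _≡ₘ_ : ℕ → ℕ → Set
  a ≡ₘ b = a % n ≡ b % n

  modSetoid : Setoid 0ℓ 0ℓ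
  modSetoid = On.setoid (≡.setoid ℕ) (_% n)

  open import Relation.Binary.Reasoning.Setoid modSetoid public

  ≡⇒≡ₘ : ∀ {a b} → a ≡ b → a ≡ₘ b
  ≡⇒≡ₘ = cong (_% n)

  n≡ₘ0 : n ≡ₘ 0
  n≡ₘ0 = trans (n%n≡0 n) (sym (m<n⇒m%n≡m (n>0)))
    where
    n>0 : 0 < n
    n>0 = >-nonZero⁻¹ n

  ≡ₘ⇒≡ : ∀ {a b} → a < n → b < n → a ≡ₘ b → a ≡ b
  ≡ₘ⇒≡ a<n b<n a≡b = trans (sym (m<n⇒m%n≡m a<n)) (trans a≡b (m<n⇒m%n≡m b<n))

  +-congₘ : ∀ {a a′ b b′} → a ≡ₘ a′ → b ≡ₘ b′ → a + b ≡ₘ a′ + b′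
  +-congₘ {a} {a′} {b} {b′} a≡a′ b≡b′ = begin
    a + b                     ≈⟨ %-distribˡ-+ a b n ⟩
    (a % n + b % n)           ≡⟨ cong₂ _+_ a≡a′ b≡b′ ⟩
    (a′ % n + b′ % n)         ≈⟨ %-distribˡ-+ a′ b′ n ⟨
    a′ + b′                   ∎

  *-congˡₘ : ∀ j {a b} → a ≡ₘ b → j * a ≡ₘ j * b
  *-congˡₘ j {a} {b} a≡b = begin
    j * a                 ≈⟨ %-distribˡ-* j a n ⟩
    (j % n) * (a % n)     ≡⟨ cong ((j % n) *_) a≡b ⟩
    (j % n) * (b % n)     ≈⟨ %-distribˡ-* j b n ⟨
    j * b                 ∎

  -- every residue c has an additive inverse c⁻, so addition can be cancelled
  +-cancelʳₘ : ∀ {a b} c → a + c ≡ₘ b + c → a ≡ₘ b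
  +-cancelʳₘ {a} {b} c a+c≡b+c = begin
    a                 ≡⟨ +-identityʳ a ⟨
    a + 0             ≈⟨ +-congₘ {a} refl c+c⁻≡0 ⟨
    a + (c + c⁻)      ≡⟨ +-assoc a c c⁻ ⟨
    a + c + c⁻        ≈⟨ +-congₘ a+c≡b+c refl ⟩
    b + c + c⁻        ≡⟨ +-assoc b c c⁻ ⟩
    b + (c + c⁻)      ≈⟨ +-congₘ {b} refl c+c⁻≡0 ⟩
    b + 0             ≡⟨ +-identityʳ b ⟩
    b                 ∎
    where
    c⁻ : ℕ
    c⁻ = n ∸ c % n
    c+c⁻≡0 : c + c⁻ ≡ₘ 0
    c+c⁻≡0 = begin
      c + c⁻          ≈⟨ +-congₘ (m%n%n≡m%n c n) refl ⟨
      c % n + c⁻      ≡⟨ m+[n∸m]≡n (<⇒≤ (m%n<n c n)) ⟩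
      n               ≈⟨ n≡ₘ0 ⟩
      0               ∎

  residue-split : ∀ k → k < n →
    (Σ ℕ λ j → k ≡ suc j × suc (j + j) ≤ n) ⊎ (Σ ℕ λ m → k + m ≡ₘ 0 × suc (m + m) ≤ n)
  residue-split zero    0<n = inj₂ (0 , refl , 0<n)
  residue-split (suc j) k<n with suc (j + j) ≤? n
  ... | yes 2j+1≤n = inj₁ (j , refl , 2j+1≤n)
  ... | no  2j+1≰n = inj₂ (m , trans (≡⇒≡ₘ k+m≡n) n≡ₘ0 , 2m+1≤n)
    where
    m : ℕ
    m = n ∸ suc j
    k+m≡n : suc j + m ≡ n
    k+m≡n = m+[n∸m]≡n (<⇒≤ k<n)
    m<k : m < suc j
    m<k = +-cancelˡ-< (suc j) m (suc j) (subst (_< suc j + suc j) (sym k+m≡n)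
            (<-≤-trans (≰⇒> 2j+1≰n) (s≤s (+-monoʳ-≤ j (n≤1+n j)))))
    2m+1≤n : suc (m + m) ≤ n
    2m+1≤n = subst (suc (m + m) ≤_) k+m≡n (+-monoˡ-≤ m m<k)

module Dihedral (n : ℕ) .{{_ : NonZero n}} where
  open Modular n

  infixl 7 _∙_
  _∙_ : Dih n → Dih n → Dih n
  x ∙ y = _·_ n x y

  idx : Dih n → ℕ
  idx (a , _) = toℕ a

  fin-idx : ∀ m → toℕ (fin n m) ≡ₘ m
  fin-idx m = trans (cong (_% n) (toℕ-fromℕ< (m%n<n m n))) (m%n%n≡m%n m n)

  Dih-ext : ∀ {x y} → idx x ≡ₘ idx y → proj₂ x ≡ proj₂ y → x ≡ y
  Dih-ext {a , b} {c , .b} a≡c refl = cong (_, b) (toℕ-injective (≡ₘ⇒≡ (toℕ<n a) (toℕ<n c) a≡c))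

  rotation-∙ : ∀ a y → idx ((a , false) ∙ y) ≡ₘ toℕ a + idx y
  rotation-∙ a y = fin-idx (toℕ a + idx y)

  reflection-∙ : ∀ a y → idx ((a , true) ∙ y) + idx y ≡ₘ toℕ a
  reflection-∙ a (c , d) = begin
    toℕ (fin n (toℕ a + (n ∸ toℕ c))) + toℕ c  ≈⟨ +-congₘ (fin-idx (toℕ a + (n ∸ toℕ c))) refl ⟩
    toℕ a + (n ∸ toℕ c) + toℕ c                 ≡⟨ +-assoc (toℕ a) (n ∸ toℕ c) (toℕ c) ⟩
    toℕ a + (n ∸ toℕ c + toℕ c)                 ≡⟨ cong (toℕ a +_) (m∸n+n≡m (<⇒≤ (toℕ<n c))) ⟩
    toℕ a + n                                   ≈⟨ +-congₘ {toℕ a} refl n≡ₘ0 ⟩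
    toℕ a + 0                                   ≡⟨ +-identityʳ (toℕ a) ⟩
    toℕ a                                       ∎

  inverse-rotation : ∀ a → idx (inv n (a , false)) + toℕ a ≡ₘ 0
  inverse-rotation a = begin
    toℕ (fin n (n ∸ toℕ a)) + toℕ a   ≈⟨ +-congₘ (fin-idx (n ∸ toℕ a)) refl ⟩
    n ∸ toℕ a + toℕ a                 ≡⟨ m∸n+n≡m (<⇒≤ (toℕ<n a)) ⟩
    n                                 ≈⟨ n≡ₘ0 ⟩
    0                                 ∎

  idx-one : idx (one n) ≡ₘ 0
  idx-one = fin-idx 0

  ∙-identityʳ : ∀ x → x ∙ one n ≡ x
  ∙-identityʳ (a , false) = Dih-ext (begin
    idx ((a , false) ∙ one n)  ≈⟨ rotation-∙ a (one n) ⟩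
    toℕ a + idx (one n)        ≈⟨ +-congₘ {toℕ a} refl idx-one ⟩
    toℕ a + 0                  ≡⟨ +-identityʳ (toℕ a) ⟩
    toℕ a                      ∎) refl
  ∙-identityʳ (a , true) = Dih-ext (begin
    idx ((a , true) ∙ one n)            ≡⟨ +-identityʳ _ ⟨
    idx ((a , true) ∙ one n) + 0        ≈⟨ +-congₘ {idx ((a , true) ∙ one n)} refl idx-one ⟨
    idx ((a , true) ∙ one n) + idx (one n)  ≈⟨ reflection-∙ a (one n) ⟩
    toℕ a                               ∎) refl

  prod-pair : ∀ x y → prod n (x ∷ y ∷ []) ≡ x ∙ y
  prod-pair x y = cong (x ∙_) (∙-identityʳ y)

  IsReflection : Dih n → Set
  IsReflection x = proj₂ x ≡ true

  conj-reflection : ∀ g s → IsReflection s → IsReflection ((g ∙ s) ∙ inv n g)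
  conj-reflection (a , false) (p , true) refl = refl
  conj-reflection (a , true)  (p , true) refl = refl

  conj-by-rotation : ∀ a s t → IsReflection s → IsReflection t →
    ((( a , false) ∙ s) ∙ t) ∙ inv n (a , false) ≡ s ∙ t
  conj-by-rotation a (p , true) (q , true) refl refl = Dih-ext (+-cancelʳₘ (toℕ q) (begin
    idx (h ∙ g⁻¹) + toℕ q            ≈⟨ +-congₘ (rotation-∙ _ g⁻¹) refl ⟩
    idx h + idx g⁻¹ + toℕ q          ≡⟨ xy∙z≈xz∙y (idx h) (idx g⁻¹) (toℕ q) ⟩
    idx h + toℕ q + idx g⁻¹          ≈⟨ +-congₘ (reflection-∙ _ (q , true)) refl ⟩
    idx (g ∙ (p , true)) + idx g⁻¹   ≈⟨ +-congₘ (rotation-∙ a (p , true)) refl ⟩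
    toℕ a + toℕ p + idx g⁻¹          ≡⟨ xy∙z≈y∙zx (toℕ a) (toℕ p) (idx g⁻¹) ⟩
    toℕ p + (idx g⁻¹ + toℕ a)        ≈⟨ +-congₘ {toℕ p} refl (inverse-rotation a) ⟩
    toℕ p + 0                        ≡⟨ +-identityʳ (toℕ p) ⟩
    toℕ p                            ≈⟨ reflection-∙ p (q , true) ⟨
    idx ((p , true) ∙ (q , true)) + toℕ q  ∎)) refl
    where
    g g⁻¹ h : Dih n
    g = (a , false)
    g⁻¹ = inv n g
    h = (g ∙ (p , true)) ∙ (q , true)

  conj-by-reflection : ∀ a s t → IsReflection s → IsReflection t →
    (((a , true) ∙ s) ∙ t) ∙ inv n (a , true) ≡ t ∙ s
  conj-by-reflection a (p , true) (q , true) refl refl = Dih-ext (+-cancelʳₘ (toℕ p) (begin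
    idx (h ∙ g) + toℕ p                 ≈⟨ +-cancelʳₘ (toℕ a) (begin
      idx (h ∙ g) + toℕ p + toℕ a         ≡⟨ xy∙z≈xz∙y (idx (h ∙ g)) (toℕ p) (toℕ a) ⟩
      idx (h ∙ g) + toℕ a + toℕ p         ≈⟨ +-congₘ (reflection-∙ _ g) refl ⟩
      idx h + toℕ p                       ≈⟨ +-congₘ (rotation-∙ _ (q , true)) refl ⟩
      idx u + toℕ q + toℕ p               ≡⟨ xy∙z≈xz∙y (idx u) (toℕ q) (toℕ p) ⟩
      idx u + toℕ p + toℕ q               ≈⟨ +-congₘ (reflection-∙ a (p , true)) refl ⟩
      toℕ a + toℕ q                       ≡⟨ +-comm (toℕ a) (toℕ q) ⟩
      toℕ q + toℕ a                       ∎) ⟩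
    toℕ q                               ≈⟨ reflection-∙ q (p , true) ⟨
    idx ((q , true) ∙ (p , true)) + toℕ p  ∎)) refl
    where
    g u h : Dih n
    g = (a , true)
    u = g ∙ (p , true)
    h = u ∙ (q , true)

  f rf : Dih n
  f  = flp n
  rf = rot n ∙ flp n

  idx-f : idx f ≡ₘ 0
  idx-f = fin-idx 0

  idx-rf : idx rf ≡ₘ 1
  idx-rf = begin
    idx rf                          ≈⟨ rotation-∙ (fin n 1) f ⟩
    toℕ (fin n 1) + idx f           ≈⟨ +-congₘ (fin-idx 1) idx-f ⟩
    1                               ∎

  f∈S : f ∈ S-f n
  f∈S = here refl

  rf∈S : rf ∈ S-f n
  rf∈S = there (here refl)

  generators-are-reflections : ∀ {s} → s ∈ S-f n → IsReflection s
  generators-are-reflections (here refl)         = refl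
  generators-are-reflections (there (here refl)) = refl

  alternating : Dih n → Dih n → ℕ → List (Dih n)
  alternating s t zero    = s ∷ []
  alternating s t (suc j) = s ∷ t ∷ alternating s t j

  alternating-length : ∀ s t j → length (alternating s t j) ≡ suc (j + j)
  alternating-length s t zero    = refl
  alternating-length s t (suc j) = cong (suc ∘ suc) (trans (alternating-length s t j) (sym (+-suc j j)))

  alternating-letters : ∀ {S s t} → s ∈ S → t ∈ S → ∀ j → All (_∈ S) (alternating s t j)
  alternating-letters s∈S t∈S zero    = s∈S ∷ []
  alternating-letters s∈S t∈S (suc j) = s∈S ∷ t∈S ∷ alternating-letters s∈S t∈S j

  alternating-prod : ∀ p q j → let P = prod n (alternating (p , true) (q , true) j) in
    IsReflection P × idx P + j * toℕ q ≡ₘ suc j * toℕ p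
  alternating-prod p q zero = refl , ≡⇒≡ₘ (cong (λ x → idx x + 0) (∙-identityʳ (p , true)))
  alternating-prod p q (suc j) with alternating-prod p q j
  ... | P-reflection , P-idx = cong (not ∘ not) P-reflection , (begin
    idx (s ∙ (t ∙ P)) + (toℕ q + j * toℕ q)
      ≈⟨ +-congₘ {idx (s ∙ (t ∙ P))} refl (+-congₘ (reflection-∙ q P) refl) ⟨
    idx (s ∙ (t ∙ P)) + (idx (t ∙ P) + idx P + j * toℕ q)
      ≡⟨ cong (idx (s ∙ (t ∙ P)) +_) (+-assoc (idx (t ∙ P)) (idx P) (j * toℕ q)) ⟩
    idx (s ∙ (t ∙ P)) + (idx (t ∙ P) + (idx P + j * toℕ q))
      ≡⟨ +-assoc (idx (s ∙ (t ∙ P))) (idx (t ∙ P)) (idx P + j * toℕ q) ⟨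
    idx (s ∙ (t ∙ P)) + idx (t ∙ P) + (idx P + j * toℕ q)
      ≈⟨ +-congₘ (reflection-∙ p (t ∙ P)) P-idx ⟩
    toℕ p + suc j * toℕ p  ∎)
    where
    s t P : Dih n
    s = (p , true)
    t = (q , true)
    P = prod n (alternating s t j)

  HasWordWithin : List (Dih n) → Dih n → ℕ → Set
  HasWordWithin S g m = Σ (List (Dih n)) λ w → IsWord n S w g × length w ≤ m

  _≟ᴰ_ : (x y : Dih n) → Dec (x ≡ y)
  _≟ᴰ_ = ≡-dec Fin._≟_ Bool._≟_

  word-length≤ : ∀ {S g m} → HasWordWithin S g m → Σ ℕ λ k → IsWordLength n S g k × k ≤ m
  word-length≤ {S} {g} (w , isWord , w≤m) with ShortestWord.shortest S (λ v → prod n v ≟ᴰ g) isWord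
  ... | k , shortestWord , minimal = k , (shortestWord , minimal) , ≤-trans (minimal w isWord) w≤m

  reflection-word : ∀ x → IsReflection x → HasWordWithin (S-f n) x n
  reflection-word (a , true) refl with residue-split (toℕ a) (toℕ<n a)
  ... | inj₁ (j , a≡1+j , 2j+1≤n) =
    alternating rf f j ,
    (alternating-letters rf∈S f∈S j , Dih-ext P≡a (proj₁ P-shape)) ,
    subst (_≤ n) (sym (alternating-length rf f j)) 2j+1≤n
    where
    P : Dih n
    P = prod n (alternating rf f j)
    P-shape : IsReflection P × idx P + j * idx f ≡ₘ suc j * idx rf
    P-shape = alternating-prod (proj₁ rf) (proj₁ f) j
    P≡a : idx P ≡ₘ toℕ a
    P≡a = begin
      idx P                ≡⟨ trans (cong (idx P +_) (*-zeroʳ j)) (+-identityʳ (idx P)) ⟨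
      idx P + j * 0        ≈⟨ +-congₘ {idx P} refl (*-congˡₘ j idx-f) ⟨
      idx P + j * idx f    ≈⟨ proj₂ P-shape ⟩
      suc j * idx rf       ≈⟨ *-congˡₘ (suc j) idx-rf ⟩
      suc j * 1            ≡⟨ trans (*-identityʳ (suc j)) (sym a≡1+j) ⟩
      toℕ a                ∎
  ... | inj₂ (m , a+m≡0 , 2m+1≤n) =
    alternating f rf m ,
    (alternating-letters f∈S rf∈S m , Dih-ext P≡a (proj₁ P-shape)) ,
    subst (_≤ n) (sym (alternating-length f rf m)) 2m+1≤n
    where
    P : Dih n
    P = prod n (alternating f rf m)
    P-shape : IsReflection P × idx P + m * idx rf ≡ₘ suc m * idx f
    P-shape = alternating-prod (proj₁ f) (proj₁ rf) m
    P≡a : idx P ≡ₘ toℕ a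
    P≡a = +-cancelʳₘ m (begin
      idx P + m            ≡⟨ cong (idx P +_) (*-identityʳ m) ⟨
      idx P + m * 1        ≈⟨ +-congₘ {idx P} refl (*-congˡₘ m idx-rf) ⟨
      idx P + m * idx rf   ≈⟨ proj₂ P-shape ⟩
      suc m * idx f        ≈⟨ *-congˡₘ (suc m) idx-f ⟩
      suc m * 0            ≡⟨ *-zeroʳ (suc m) ⟩
      0                    ≈⟨ a+m≡0 ⟨
      toℕ a + m            ∎)

  -- a conjugate g s s' g⁻¹ of a product of two generators is s s' or s' s,
  -- hence a word of length 2
  conjugate-pair : ∀ g {s s′} → s ∈ S-f n → s′ ∈ S-f n →
    HasWordWithin (S-f n) (((g ∙ s) ∙ s′) ∙ inv n g) 2
  conjugate-pair (a , false) {s} {s′} s∈S s′∈S =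
    s ∷ s′ ∷ [] , (s∈S ∷ s′∈S ∷ [] , trans (prod-pair s s′) (sym conj)) , ≤-refl
    where
    conj : (((a , false) ∙ s) ∙ s′) ∙ inv n (a , false) ≡ s ∙ s′
    conj = conj-by-rotation a s s′ (generators-are-reflections s∈S) (generators-are-reflections s′∈S)
  conjugate-pair (a , true) {s} {s′} s∈S s′∈S =
    s′ ∷ s ∷ [] , (s′∈S ∷ s∈S ∷ [] , trans (prod-pair s′ s) (sym conj)) , ≤-refl
    where
    conj : (((a , true) ∙ s) ∙ s′) ∙ inv n (a , true) ≡ s′ ∙ s
    conj = conj-by-reflection a s s′ (generators-are-reflections s∈S) (generators-are-reflections s′∈S)

  -- r = rf · f is neither the identity nor a reflection, so l(r) = 2 once n ≥ 2
  r-length : 2 ≤ n → IsWordLength n (S-f n) (rf ∙ f) 2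
  r-length 2≤n = (rf ∷ f ∷ [] , (rf∈S ∷ f∈S ∷ [] , prod-pair rf f) , refl) , minimal
    where
    idx-r : idx (rf ∙ f) ≡ₘ 1
    idx-r = begin
      idx (rf ∙ f)              ≡⟨ +-identityʳ _ ⟨
      idx (rf ∙ f) + 0          ≈⟨ +-congₘ {idx (rf ∙ f)} refl idx-f ⟨
      idx (rf ∙ f) + idx f      ≈⟨ reflection-∙ (proj₁ rf) f ⟩
      idx rf                    ≈⟨ idx-rf ⟩
      1                         ∎
    r≢one : one n ≢ rf ∙ f
    r≢one one≡r = 0≢1+n (≡ₘ⇒≡ (>-nonZero⁻¹ n) 2≤n (begin
      0                         ≈⟨ idx-one ⟨
      idx (one n)               ≡⟨ cong idx one≡r ⟩
      idx (rf ∙ f)              ≈⟨ idx-r ⟩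
      1                         ∎))
    minimal : ∀ w → IsWord n (S-f n) w (rf ∙ f) → 2 ≤ length w
    minimal []              (_ , one≡r)      = ⊥-elim (r≢one one≡r)
    minimal (_ ∷ [])        (here refl ∷ [] , ())
    minimal (_ ∷ [])        (there (here refl) ∷ [] , ())
    minimal (_ ∷ _ ∷ _)     _                = s≤s (s≤s z≤n)

theorem5 : (n : ℕ) .{{_ : NonZero n}} → 3 ≤ n →
    Lambda1≤ n (S-f n) n × Lambda2≡ n (S-f n) 2
theorem5 n 3≤n = lambda1 , lambda2-bound , (one n , rf , f , rf∈S , f∈S , r-attains)
  where
  open Dihedral n

  lambda1 : Lambda1≤ n (S-f n) n
  lambda1 g s s∈S = word-length≤ (reflection-word ((g ∙ s) ∙ inv n g)
    (conj-reflection g s (generators-are-reflections s∈S)))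

  lambda2-bound : ∀ g s s′ → s ∈ S-f n → s′ ∈ S-f n →
    Σ ℕ λ k → IsWordLength n (S-f n) (((g ∙ s) ∙ s′) ∙ inv n g) k × k ≤ 2
  lambda2-bound g s s′ s∈S s′∈S = word-length≤ (conjugate-pair g s∈S s′∈S)

  r-attains : IsWordLength n (S-f n) (((one n ∙ rf) ∙ f) ∙ inv n (one n)) 2
  r-attains = subst (λ x → IsWordLength n (S-f n) x 2)
    (sym (conj-by-rotation (proj₁ (one n)) rf f refl refl)) (r-length (≤-trans (n≤1+n 2) 3≤n))
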